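{- Let $\Gamma$ be a finite simple undirected graph and let $C$ be a clique of $\Gamma$ with $|C|=\omega(\Gamma)$. Suppose there exist a partition $\{A_1,\ldots,A_s\}$ of $V(\Gamma)\setminus C$ and a partition $\{C_1,\ldots,C_s,C_{s+1}\}$ of $C$ such that for each $i\in\{1,\ldots,s\}$: (i) $|A_i|\le |C_i|-1$; and (ii) every vertex in $A_i$ is nonadjacent in $\Gamma$ to every vertex in $C_i$. Then $\lambda(\Gamma)=2\omega(\Gamma)-2$.
   Context: A clique is a set of pairwise adjacent vertices; $\omega(\Gamma)$ denotes the maximum cardinality of a clique of $\Gamma$. An $L(2,1)$-labeling of a graph $\Gamma$ is a function $f:V(\Gamma)\to\mathbb{Z}_{\ge 0}$ such that $|f(u)-f(v)|\ge 2$ whenever $u,v$ are adjacent and $|f(u)-f(v)|\ge 1$ whenever $u,v$ are at distance two. The span of $f$ is $\max f-\min f$, and $\lambda(\Gamma)$ is the minimum span over all $L(2,1)$-labelings of $\Gamma$. -}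

module Defs where

open import Data.Nat using (ℕ; zero; suc; _+_; _*_; _∸_; _≤_; _⊔_; _⊓_)
open import Data.Fin using (Fin; fromℕ; inject₁)
open import Data.Fin.Subset using (Subset; _∈_; _∉_; ∣_∣)
open import Data.Fin.Subset.Properties using (_∈?_)
open import Data.List using (List; foldr; map; length; filter; allFin)
open import Data.Product using (Σ; ∃; _×_; _,_)
open import Data.Sum using (_⊎_)
open import Relation.Nullary using (¬_; Dec)
open import Relation.Nullary.Decidable using (_×-dec_; ¬?)
open import Relation.Binary.PropositionalEquality using (_≡_; _≢_)
import Data.Fin.Properties as FinP

record Graph (n : ℕ) : Set₁ where
  field
    Adj     : Fin n → Fin n → Set
    adj?    : ∀ u v → Dec (Adj u v)
    sym     : ∀ {u v} → Adj u v → Adj v u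
    irrefl  : ∀ {u} → ¬ Adj u u
open Graph public

module _ {n : ℕ} (Γ : Graph n) where

  IsClique : Subset n → Set
  IsClique C = ∀ u v → u ∈ C → v ∈ C → u ≢ v → Adj Γ u v

  IsMaximumClique : Subset n → Set
  IsMaximumClique C = IsClique C × (∀ D → IsClique D → ∣ D ∣ ≤ ∣ C ∣)

  Dist2 : Fin n → Fin n → Set
  Dist2 u v = u ≢ v × ¬ Adj Γ u v × ∃ λ w → Adj Γ u w × Adj Γ w v

  IsL21 : (Fin n → ℕ) → Set
  IsL21 f = (∀ u v → Adj Γ u v → (f u + 2 ≤ f v ⊎ f v + 2 ≤ f u))
          × (∀ u v → Dist2 u v → f u ≢ f v)

-- max f and min f over all vertices (for n ≥ 1 these are the true max/min).
maxLabel : ∀ {n} → (Fin n → ℕ) → ℕ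
maxLabel {n} f = foldr _⊔_ 0 (map f (allFin n))

minLabel : ∀ {n} → (Fin n → ℕ) → ℕ
minLabel {n} f = foldr _⊓_ (maxLabel f) (map f (allFin n))

span : ∀ {n} → (Fin n → ℕ) → ℕ
span f = maxLabel f ∸ minLabel f

IsLambda : ∀ {n} → Graph n → ℕ → Set
IsLambda Γ k = (∃ λ f → IsL21 Γ f × span f ≡ k)
             × (∀ f → IsL21 Γ f → k ≤ span f)

cardA : ∀ {n s} → Subset n → (Fin n → Fin s) → Fin s → ℕ
cardA {n} C a i = length (filter (λ v → ¬? (v ∈? C) ×-dec (a v FinP.≟ i)) (allFin n))

cardC : ∀ {n s} → Subset n → (Fin n → Fin (suc s)) → Fin (suc s) → ℕ
cardC {n} C c i = length (filter (λ v → (v ∈? C) ×-dec (c v FinP.≟ i)) (allFin n))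

-- The labels of a clique are pairwise at distance at least 2, so ω labels need a span of at
-- least 2ω − 2. Conversely, order C by the class index of the partition (C₁, …, C_{s+1}) and
-- give the k-th clique vertex the label 2k; the vertices of A_i get the odd labels strictly
-- inside the even block of C_i, which has room for them because |A_i| ≤ |C_i| − 1. All
-- labels are then distinct and lie in [0, 2ω − 2], and two labels of equal parity differ by
-- at least 2. An odd label is adjacent to an even one only when the vertex of A_i sees a
-- vertex of C_i, which hypothesis (ii) forbids.
module Submission where

open import Defs hiding (sym)
open import Data.Nat using (ℕ; suc; _+_; _*_; _∸_; _≤_; _<_; z≤n; s≤s; z<s; _<?_)
open import Data.Nat.Properties
open import Data.Fin as Fin using (Fin; toℕ; inject₁)
import Data.Vec as Vec
import Data.Fin.Properties as Finₚ
open import Data.Fin.Subset using (Subset; inside; outside; ∣_∣; _∉_; _∈_)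
open import Data.Fin.Subset.Properties using (_∈?_; drop-there)
open import Data.List using (List; []; _∷_; filter; length; map; tabulate; allFin)
open import Data.List.Properties using (filter-accept; filter-reject; filter-all; filter-none; length-map; foldr-preservesᵇ; foldr-preservesᵒ)
open import Data.List.Membership.Propositional using () renaming (_∈_ to _∈ₗ_)
open import Data.List.Membership.Propositional.Properties using (∈-allFin)
open import Data.List.Relation.Unary.Any using (here; there)
import Data.List.Relation.Unary.Any.Properties as Any
open import Data.List.Relation.Unary.All as All using (All; []; _∷_)
import Data.List.Relation.Unary.All.Properties as All
open import Data.List.Relation.Unary.AllPairs using (AllPairs; []; _∷_)
import Data.List.Relation.Unary.AllPairs.Properties as AllPairs
import Data.List.Relation.Unary.Unique.Propositional.Properties as Unique
open import Data.Product using (_×_; _,_; proj₁; proj₂)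
open import Data.Sum using (_⊎_; inj₁; inj₂; [_,_])
open import Level using (0ℓ)
open import Function using (_∘_; id)
open import Relation.Nullary using (yes; no; ¬_; contradiction)
open import Relation.Nullary.Decidable using (_×-dec_; ¬?; toSum)
open import Relation.Unary using (Pred; Decidable; _⊆_)
open import Relation.Binary using (tri<; tri≈; tri>)
open import Relation.Binary.PropositionalEquality using (_≡_; _≢_; refl; sym; trans; cong; subst)

count : {A : Set} {P : Pred A 0ℓ} → Decidable P → List A → ℕ
count P? xs = length (filter P? xs)

module _ {A : Set} {P : Pred A 0ℓ} (P? : Decidable P) {x : A} {xs : List A} where

  count-accept : P x → count P? (x ∷ xs) ≡ suc (count P? xs)
  count-accept Px = cong length (filter-accept P? Px)

  count-reject : ¬ P x → count P? (x ∷ xs) ≡ count P? xs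
  count-reject ¬Px = cong length (filter-reject P? ¬Px)

module _ {A : Set} {P Q : Pred A 0ℓ} (P? : Decidable P) (Q? : Decidable Q) where

  count-mono : ∀ {xs} → All (λ x → P x → Q x) xs → count P? xs ≤ count Q? xs
  count-mono {[]} [] = z≤n
  count-mono {x ∷ xs} (P⇒Q ∷ hs) with P? x | Q? x
  ... | yes _  | yes _  = s≤s (count-mono hs)
  ... | yes Px | no ¬Qx = contradiction (P⇒Q Px) ¬Qx
  ... | no _   | yes _  = m≤n⇒m≤1+n (count-mono hs)
  ... | no _   | no _   = count-mono hs

  count-mono-⊆ : P ⊆ Q → ∀ xs → count P? xs ≤ count Q? xs
  count-mono-⊆ P⊆Q xs = count-mono (All.universal (λ _ → P⊆Q) xs)

  count-mono-< : P ⊆ Q → ∀ {x xs} → x ∈ₗ xs → Q x → ¬ P x → count P? xs < count Q? xs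
  count-mono-< P⊆Q {x} {_ ∷ xs} (here refl) Qx ¬Px with P? x | Q? x
  ... | yes Px | _      = contradiction Px ¬Px
  ... | no _   | yes _  = s≤s (count-mono-⊆ P⊆Q xs)
  ... | no _   | no ¬Qx = contradiction Qx ¬Qx
  count-mono-< P⊆Q {xs = y ∷ _} (there x∈xs) Qx ¬Px with P? y | Q? y
  ... | yes _  | yes _  = s≤s (count-mono-< P⊆Q x∈xs Qx ¬Px)
  ... | yes Py | no ¬Qy = contradiction (P⊆Q Py) ¬Qy
  ... | no _   | yes _  = m<n⇒m<1+n (count-mono-< P⊆Q x∈xs Qx ¬Px)
  ... | no _   | no _   = count-mono-< P⊆Q x∈xs Qx ¬Px

  count-disjoint : {R : Pred A 0ℓ} (R? : Decidable R) → P ⊆ R → Q ⊆ R → (∀ {x} → P x → ¬ Q x)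
                 → ∀ xs → count P? xs + count Q? xs ≤ count R? xs
  count-disjoint R? P⊆R Q⊆R P∩Q≡∅ [] = z≤n
  count-disjoint R? P⊆R Q⊆R P∩Q≡∅ (x ∷ xs) with count-disjoint R? P⊆R Q⊆R P∩Q≡∅ xs | P? x | Q? x | R? x
  ... | _  | yes Px | yes Qx | _      = contradiction Qx (P∩Q≡∅ Px)
  ... | ih | yes _  | no _   | yes _  = s≤s ih
  ... | ih | no _   | yes _  | yes _  = subst (_≤ suc (count R? xs)) (sym (+-suc (count P? xs) (count Q? xs))) (s≤s ih)
  ... | ih | no _   | no _   | yes _  = m≤n⇒m≤1+n ih
  ... | ih | no _   | no _   | no _   = ih
  ... | _  | yes Px | no _   | no ¬Rx = contradiction (P⊆R Px) ¬Rx
  ... | _  | no _   | yes Qx | no ¬Rx = contradiction (Q⊆R Qx) ¬Rx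

∣p∣≡count-tabulate : ∀ {A : Set} {P : Pred A 0ℓ} {n} (p : Subset n) (P? : Decidable P) (g : Fin n → A)
                   → (∀ i → i ∈ p → P (g i)) → (∀ i → P (g i) → i ∈ p)
                   → ∣ p ∣ ≡ count P? (tabulate g)
∣p∣≡count-tabulate Vec.[]              P? g ∈⇒P P⇒∈ = refl
∣p∣≡count-tabulate (inside Vec.∷ p)  P? g ∈⇒P P⇒∈ with P? (g Fin.zero)
... | yes _   = cong suc (∣p∣≡count-tabulate p P? (g ∘ Fin.suc) (λ i → ∈⇒P (Fin.suc i) ∘ Vec.there) (λ i → drop-there ∘ P⇒∈ (Fin.suc i)))
... | no ¬Pg₀ = contradiction (∈⇒P Fin.zero Vec.here) ¬Pg₀
∣p∣≡count-tabulate (outside Vec.∷ p) P? g ∈⇒P P⇒∈ with P? (g Fin.zero)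
... | yes Pg₀ = contradiction (P⇒∈ Fin.zero Pg₀) λ ()
... | no _    = ∣p∣≡count-tabulate p P? (g ∘ Fin.suc) (λ i → ∈⇒P (Fin.suc i) ∘ Vec.there) (λ i → drop-there ∘ P⇒∈ (Fin.suc i))

∣p∣≡count : ∀ {n} (p : Subset n) → ∣ p ∣ ≡ count (_∈? p) (allFin n)
∣p∣≡count p = ∣p∣≡count-tabulate p (_∈? p) id (λ _ → id) (λ _ → id)

AllPairs-mapWith : ∀ {A : Set} {P : Pred A 0ℓ} {R S : A → A → Set}
                 → (∀ {x y} → P x → P y → R x y → S x y)
                 → ∀ {xs} → All P xs → AllPairs R xs → AllPairs S xs
AllPairs-mapWith f [] [] = []
AllPairs-mapWith f (px ∷ pxs) (Rx ∷ Rxs) =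
  All.zipWith (λ { (py , Rxy) → f px py Rxy }) (pxs , Rx) ∷ AllPairs-mapWith f pxs Rxs

Apart : ℕ → ℕ → Set
Apart x y = x + 2 ≤ y ⊎ y + 2 ≤ x

Apart-sym : ∀ {x y} → Apart x y → Apart y x
Apart-sym (inj₁ x+2≤y) = inj₂ x+2≤y
Apart-sym (inj₂ y+2≤x) = inj₁ y+2≤x

Apart⇒≢ : ∀ {x y} → Apart x y → x ≢ y
Apart⇒≢ (inj₁ x+2≤x) refl = <-irrefl refl (<-≤-trans (m<m+n _ z<s) x+2≤x)
Apart⇒≢ (inj₂ x+2≤x) refl = <-irrefl refl (<-≤-trans (m<m+n _ z<s) x+2≤x)

Apart-suc : ∀ {x y} → Apart x y → Apart (suc x) (suc y)
Apart-suc (inj₁ x+2≤y) = inj₁ (s≤s x+2≤y)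
Apart-suc (inj₂ y+2≤x) = inj₂ (s≤s y+2≤x)

double-< : ∀ {x y} → x < y → 2 * x + 2 ≤ 2 * y
double-< {x} x<y = ≤-trans (≤-reflexive (trans (+-comm (2 * x) 2) (sym (*-suc 2 x)))) (*-monoʳ-≤ 2 x<y)

double-suc-< : ∀ {x y} → suc x < y → suc (2 * x) + 2 ≤ 2 * y
double-suc-< {x} sx<y = ≤-trans (+-monoˡ-≤ 2 (≤-trans (n≤1+n _) (≤-reflexive (sym (*-suc 2 x))))) (double-< sx<y)

double-apart : ∀ {x y} → x < y ⊎ y < x → Apart (2 * x) (2 * y)
double-apart (inj₁ x<y) = inj₁ (double-< x<y)
double-apart (inj₂ y<x) = inj₂ (double-< y<x)

count-<2+ : ∀ {t ns} → AllPairs Apart ns → count (_<? 2 + t) ns ≤ suc (count (_<? t) ns)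
count-<2+ [] = z≤n
count-<2+ {t} {x ∷ ns} (x-apart ∷ apart) with x <? t | x <? 2 + t
... | yes x<t | yes x<2+t = begin
  count (_<? 2 + t) (x ∷ ns)    ≡⟨ count-accept (_<? 2 + t) x<2+t ⟩
  suc (count (_<? 2 + t) ns)    ≤⟨ s≤s (count-<2+ apart) ⟩
  suc (suc (count (_<? t) ns))  ≡⟨ cong suc (count-accept (_<? t) x<t) ⟨
  suc (count (_<? t) (x ∷ ns))  ∎
  where open ≤-Reasoning
... | yes x<t | no x≮2+t  = contradiction (m≤n⇒m≤o+n 2 x<t) x≮2+t
... | no x≮t  | yes x<2+t = begin
  count (_<? 2 + t) (x ∷ ns)    ≡⟨ count-accept (_<? 2 + t) x<2+t ⟩
  suc (count (_<? 2 + t) ns)    ≤⟨ s≤s (count-mono _ _ (All.map below-t x-apart)) ⟩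
  suc (count (_<? t) ns)        ≡⟨ cong suc (count-reject (_<? t) x≮t) ⟨
  suc (count (_<? t) (x ∷ ns))  ∎
  where
  open ≤-Reasoning
  below-t : ∀ {y} → Apart x y → y < 2 + t → y < t
  below-t (inj₁ x+2≤y) y<2+t =
    contradiction (≤-trans (≤-reflexive (+-comm 2 t)) (≤-trans (+-monoˡ-≤ 2 (≮⇒≥ x≮t)) x+2≤y)) (<⇒≱ y<2+t)
  below-t {y} (inj₂ y+2≤x) _ =
    +-cancelˡ-≤ 2 _ _ (subst (_≤ 2 + t) (cong suc (+-comm y 2)) (≤-<-trans y+2≤x x<2+t))
... | no x≮t  | no x≮2+t = begin
  count (_<? 2 + t) (x ∷ ns)    ≡⟨ count-reject (_<? 2 + t) x≮2+t ⟩
  count (_<? 2 + t) ns          ≤⟨ count-<2+ apart ⟩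
  suc (count (_<? t) ns)        ≡⟨ cong suc (count-reject (_<? t) x≮t) ⟨
  suc (count (_<? t) (x ∷ ns))  ∎
  where open ≤-Reasoning

count-<-lower-bound : ∀ {m ns} → All (m ≤_) ns → count (_<? m) ns ≡ 0
count-<-lower-bound m≤ns = cong length (filter-none (_<? _) (All.map ≤⇒≯ m≤ns))

count-apart-< : ∀ {m ns} → All (m ≤_) ns → AllPairs Apart ns → ∀ j → 2 * count (_<? j + m) ns ≤ suc j
count-apart-< m≤ns apart 0 rewrite count-<-lower-bound m≤ns = z≤n
count-apart-< {m} {ns} m≤ns apart 1 = *-monoʳ-≤ 2 (begin
  count (_<? suc m) ns       ≤⟨ count-mono-⊆ _ _ m<n⇒m<1+n ns ⟩
  count (_<? 2 + m) ns       ≤⟨ count-<2+ apart ⟩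
  suc (count (_<? 0 + m) ns) ≤⟨ s≤s (≤-reflexive (count-<-lower-bound m≤ns)) ⟩
  1                          ∎)
  where open ≤-Reasoning
count-apart-< {m} {ns} m≤ns apart (suc (suc j)) = begin
  2 * count (_<? 2 + (j + m)) ns      ≤⟨ *-monoʳ-≤ 2 (count-<2+ apart) ⟩
  2 * suc (count (_<? j + m) ns)      ≡⟨ *-suc 2 _ ⟩
  2 + 2 * count (_<? j + m) ns        ≤⟨ +-monoʳ-≤ 2 (count-apart-< m≤ns apart j) ⟩
  2 + suc j                           ∎
  where open ≤-Reasoning

apart-length : ∀ {m M} ns → All (λ k → m ≤ k × k ≤ M) ns → AllPairs Apart ns → 2 * length ns ∸ 2 ≤ M ∸ m
apart-length [] _ _ = z≤n
apart-length {m} {M} ns@(_ ∷ _) bounds@((m≤k , k≤M) ∷ _) apart = m≤n+o⇒m∸n≤o (2 * length ns) 2 (begin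
  2 * length ns                       ≡⟨ cong (2 *_) all-below ⟨
  2 * count (_<? suc (M ∸ m) + m) ns  ≤⟨ count-apart-< (All.map proj₁ bounds) apart (suc (M ∸ m)) ⟩
  2 + (M ∸ m)                         ∎)
  where
  open ≤-Reasoning
  all-below : count (_<? suc (M ∸ m) + m) ns ≡ length ns
  all-below rewrite m∸n+n≡m (≤-trans m≤k k≤M) =
    cong length (filter-all (_<? suc M) (All.map (s≤s ∘ proj₂) bounds))

≤maxLabel : ∀ {n} (f : Fin n → ℕ) x → f x ≤ maxLabel f
≤maxLabel f x = foldr-preservesᵒ {P = f x ≤_} (λ a b → [ m≤n⇒m≤n⊔o b , m≤n⇒m≤o⊔n a ]) 0 _
                  (inj₂ (Any.map⁺ (Any.tabulate⁺ x ≤-refl)))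

minLabel≤ : ∀ {n} (f : Fin n → ℕ) x → minLabel f ≤ f x
minLabel≤ f x = foldr-preservesᵒ {P = _≤ f x} (λ a b → [ m≤n⇒m⊓o≤n b , m≤n⇒o⊓m≤n a ]) (maxLabel f) _
                  (inj₂ (Any.map⁺ (Any.tabulate⁺ x ≤-refl)))

span≤ : ∀ {n} {f : Fin n → ℕ} {B} → (∀ x → f x ≤ B) → span f ≤ B
span≤ {f = f} {B} f≤B = ≤-trans (m∸n≤m (maxLabel f) (minLabel f))
                            (foldr-preservesᵇ {P = _≤ B} ⊔-lub z≤n (All.map⁺ (All.tabulate⁺ f≤B)))

clique-span : ∀ {n} (Γ : Graph n) {C : Subset n} {f : Fin n → ℕ}
            → IsClique Γ C → IsL21 Γ f → 2 * ∣ C ∣ ∸ 2 ≤ span f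
clique-span {n} Γ {C} {f} clique (adjacent-apart , _) = begin
  2 * ∣ C ∣ ∸ 2          ≡⟨ cong (λ k → 2 * k ∸ 2) ∣C∣≡∣labels∣ ⟩
  2 * length labels ∸ 2  ≤⟨ apart-length labels bounds apart ⟩
  span f                 ∎
  where
  open ≤-Reasoning
  members : List (Fin n)
  members = filter (_∈? C) (allFin n)
  labels : List ℕ
  labels = map f members
  ∣C∣≡∣labels∣ : ∣ C ∣ ≡ length labels
  ∣C∣≡∣labels∣ = trans (∣p∣≡count C) (sym (length-map f members))
  bounds : All (λ k → minLabel f ≤ k × k ≤ maxLabel f) labels
  bounds = All.map⁺ (All.universal (λ x → minLabel≤ f x , ≤maxLabel f x) members)
  apart : AllPairs Apart labels
  apart = AllPairs.map⁺ (AllPairs-mapWith (λ xC yC x≢y → adjacent-apart _ _ (clique _ _ xC yC x≢y))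
                                          (All.all-filter (_∈? C) (allFin n))
                                          (Unique.filter⁺ (_∈? C) (Unique.allFin⁺ n)))

before : ∀ {n m} {P : Pred (Fin n) 0ℓ} → Decidable P → (Fin n → Fin m) → Fin n → ℕ
before {n} P? cls v = count (λ w → P? w ×-dec (cls w Finₚ.≟ cls v) ×-dec (w Finₚ.<? v)) (allFin n)

module _ {n m} {P : Pred (Fin n) 0ℓ} (P? : Decidable P) (cls : Fin n → Fin m) where

  before<classSize : ∀ {v} → P v → before P? cls v < count (λ w → P? w ×-dec (cls w Finₚ.≟ cls v)) (allFin n)
  before<classSize {v} Pv =
    count-mono-< _ _ (λ { (Pw , same , _) → Pw , same }) (∈-allFin v) (Pv , refl) (λ { (_ , _ , v<v) → Finₚ.<-irrefl refl v<v })

  before-mono : ∀ {u v} → P u → cls u ≡ cls v → u Fin.< v → before P? cls u < before P? cls v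
  before-mono {u} Pu same u<v =
    count-mono-< _ _ (λ { (Pw , same′ , w<u) → Pw , trans same′ same , Finₚ.<-trans w<u u<v })
                 (∈-allFin u) (Pu , same , u<v) (λ { (_ , _ , u<u) → Finₚ.<-irrefl refl u<u })

module Labelling {n s} (Γ : Graph n) (C : Subset n) (a : Fin n → Fin s) (c : Fin n → Fin (suc s))
  (|Aᵢ|<|Cᵢ| : ∀ i → cardA C a i + 1 ≤ cardC C c (inject₁ i))
  (Aᵢ≁Cᵢ : ∀ i u v → u ∉ C → a u ≡ i → v ∈ C → c v ≡ inject₁ i → ¬ Adj Γ u v) where

  below : ℕ → ℕ
  below k = count (λ w → (w ∈? C) ×-dec (toℕ (c w) <? k)) (allFin n)

  below-mono : ∀ {k l} → k ≤ l → below k ≤ below l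
  below-mono k≤l = count-mono-⊆ _ _ (λ { (wC , w<k) → wC , <-≤-trans w<k k≤l }) (allFin n)

  below≤∣C∣ : ∀ k → below k ≤ ∣ C ∣
  below≤∣C∣ k = ≤-trans (count-mono-⊆ _ (_∈? C) proj₁ (allFin n)) (≤-reflexive (sym (∣p∣≡count C)))

  below-step : ∀ j {k} → toℕ j ≡ k → below k + cardC C c j ≤ below (suc k)
  below-step j refl =
    count-disjoint _ _ _ (λ { (wC , w<k) → wC , m<n⇒m<1+n w<k })
                         (λ { (wC , same) → wC , s≤s (≤-reflexive (cong toℕ same)) })
                         (λ { (_ , w<k) (_ , same) → <-irrefl (cong toℕ same) w<k })
                         (allFin n)

  position : ∀ {m} {P : Pred (Fin n) 0ℓ} → Decidable P → (Fin n → Fin m) → Fin n → ℕ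
  position P? cls v = below (toℕ (cls v)) + before P? cls v

  module _ {m} {P : Pred (Fin n) 0ℓ} (P? : Decidable P) (cls : Fin n → Fin m)
           (bounded : ∀ {v} → P v → position P? cls v < below (suc (toℕ (cls v)))) where

    position-<-level : ∀ {u v} → P u → toℕ (cls u) < toℕ (cls v) → position P? cls u < position P? cls v
    position-<-level Pu lu<lv = <-≤-trans (bounded Pu) (≤-trans (below-mono lu<lv) (m≤m+n _ _))

    position-separates : ∀ {u v} → P u → P v → u ≢ v
                       → position P? cls u < position P? cls v ⊎ position P? cls v < position P? cls u
    position-separates {u} {v} Pu Pv u≢v with <-cmp (toℕ (cls u)) (toℕ (cls v)) | Finₚ.<-cmp u v
    ... | tri< lu<lv _ _ | _            = inj₁ (position-<-level Pu lu<lv)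
    ... | tri> _ _ lv<lu | _            = inj₂ (position-<-level Pv lv<lu)
    ... | tri≈ _ lu≡lv _ | tri< u<v _ _ =
      inj₁ (+-mono-≤-< (below-mono (≤-reflexive lu≡lv)) (before-mono P? cls Pu (Finₚ.toℕ-injective lu≡lv) u<v))
    ... | tri≈ _ lu≡lv _ | tri> _ _ v<u =
      inj₂ (+-mono-≤-< (below-mono (≤-reflexive (sym lu≡lv))) (before-mono P? cls Pv (Finₚ.toℕ-injective (sym lu≡lv)) v<u))
    ... | tri≈ _ _ _     | tri≈ _ u≡v _ = contradiction u≡v u≢v

  ∉C? : Decidable (_∉ C)
  ∉C? w = ¬? (w ∈? C)

  rank : Fin n → ℕ
  rank = position (_∈? C) c

  gap : Fin n → ℕ
  gap = position ∉C? a

  rank-bounded : ∀ {v} → v ∈ C → rank v < below (suc (toℕ (c v)))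
  rank-bounded {v} vC = begin-strict
    below (toℕ (c v)) + before (_∈? C) c v  <⟨ +-monoʳ-< _ (before<classSize (_∈? C) c vC) ⟩
    below (toℕ (c v)) + cardC C c (c v)      ≤⟨ below-step (c v) refl ⟩
    below (suc (toℕ (c v)))                  ∎
    where open ≤-Reasoning

  -- The margin of one over rank-bounded is where |A_i| ≤ |C_i| − 1 enters: it keeps the odd
  -- labels of A_i below the largest even label of C_i.
  gap-bounded : ∀ {u} → u ∉ C → suc (gap u) < below (suc (toℕ (a u)))
  gap-bounded {u} u∉C = begin-strict
    suc (below (toℕ (a u)) + before ∉C? a u)   ≡⟨ +-suc _ _ ⟨
    below (toℕ (a u)) + suc (before ∉C? a u)   <⟨ +-monoʳ-< _ (s≤s (before<classSize ∉C? a u∉C)) ⟩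
    below (toℕ (a u)) + suc (cardA C a (a u))  ≡⟨ cong (below (toℕ (a u)) +_) (+-comm 1 _) ⟩
    below (toℕ (a u)) + (cardA C a (a u) + 1)  ≤⟨ +-monoʳ-≤ _ (|Aᵢ|<|Cᵢ| (a u)) ⟩
    below (toℕ (a u)) + cardC C c (inject₁ (a u)) ≤⟨ below-step (inject₁ (a u)) (Finₚ.toℕ-inject₁ (a u)) ⟩
    below (suc (toℕ (a u)))                    ∎
    where open ≤-Reasoning

  label : Fin n → ℕ
  label v with v ∈? C
  ... | yes _ = 2 * rank v
  ... | no _  = suc (2 * gap v)

  label-∈ : ∀ {v} → v ∈ C → label v ≡ 2 * rank v
  label-∈ {v} vC with v ∈? C
  ... | yes _   = refl
  ... | no v∉C  = contradiction vC v∉C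

  label-∉ : ∀ {v} → v ∉ C → label v ≡ suc (2 * gap v)
  label-∉ {v} v∉C with v ∈? C
  ... | yes vC = contradiction vC v∉C
  ... | no _   = refl

  label-apart-∈ : ∀ {u v} → u ∈ C → v ∈ C → u ≢ v → Apart (label u) (label v)
  label-apart-∈ uC vC u≢v rewrite label-∈ uC | label-∈ vC =
    double-apart (position-separates (_∈? C) c rank-bounded uC vC u≢v)

  label-apart-∉ : ∀ {u v} → u ∉ C → v ∉ C → u ≢ v → Apart (label u) (label v)
  label-apart-∉ u∉C v∉C u≢v rewrite label-∉ u∉C | label-∉ v∉C =
    Apart-suc (double-apart (position-separates ∉C? a (<-trans (n<1+n _) ∘ gap-bounded) u∉C v∉C u≢v))

  label-apart-∈∉ : ∀ {u v} → u ∈ C → v ∉ C → toℕ (c u) ≢ toℕ (a v) → Apart (label u) (label v)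
  label-apart-∈∉ {u} {v} uC v∉C cu≢av rewrite label-∈ uC | label-∉ v∉C with <-cmp (toℕ (c u)) (toℕ (a v))
  ... | tri< cu<av _ _ = inj₁ (≤-trans (double-< rank<gap) (n≤1+n _))
    where
    rank<gap : rank u < gap v
    rank<gap = <-≤-trans (rank-bounded uC) (≤-trans (below-mono cu<av) (m≤m+n _ _))
  ... | tri≈ _ cu≡av _ = contradiction cu≡av cu≢av
  ... | tri> _ _ av<cu = inj₂ (double-suc-< gap<rank)
    where
    gap<rank : suc (gap v) < rank u
    gap<rank = <-≤-trans (gap-bounded v∉C) (≤-trans (below-mono av<cu) (m≤m+n _ _))

  adjacent-classes-differ : ∀ {u v} → u ∈ C → v ∉ C → Adj Γ u v → toℕ (c u) ≢ toℕ (a v)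
  adjacent-classes-differ {u} {v} uC v∉C uv cu≡av =
    Aᵢ≁Cᵢ (a v) v u v∉C refl uC (Finₚ.toℕ-injective (trans cu≡av (sym (Finₚ.toℕ-inject₁ (a v))))) (Graph.sym Γ uv)

  label-injective : ∀ {u v} → u ≢ v → label u ≢ label v
  label-injective {u} {v} u≢v with toSum (u ∈? C) | toSum (v ∈? C)
  ... | inj₁ uC  | inj₁ vC  = Apart⇒≢ (label-apart-∈ uC vC u≢v)
  ... | inj₂ u∉C | inj₂ v∉C = Apart⇒≢ (label-apart-∉ u∉C v∉C u≢v)
  ... | inj₁ uC  | inj₂ v∉C = λ same → even≢odd (rank u) (gap v) (trans (sym (label-∈ uC)) (trans same (label-∉ v∉C)))
  ... | inj₂ u∉C | inj₁ vC  = λ same → even≢odd (rank v) (gap u) (trans (sym (label-∈ vC)) (trans (sym same) (label-∉ u∉C)))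

  label-apart : ∀ {u v} → Adj Γ u v → Apart (label u) (label v)
  label-apart {u} {v} uv with toSum (u ∈? C) | toSum (v ∈? C)
  ... | inj₁ uC  | inj₁ vC  = label-apart-∈ uC vC λ { refl → Graph.irrefl Γ uv }
  ... | inj₂ u∉C | inj₂ v∉C = label-apart-∉ u∉C v∉C λ { refl → Graph.irrefl Γ uv }
  ... | inj₁ uC  | inj₂ v∉C = label-apart-∈∉ uC v∉C (adjacent-classes-differ uC v∉C uv)
  ... | inj₂ u∉C | inj₁ vC  = Apart-sym (label-apart-∈∉ vC u∉C (adjacent-classes-differ vC u∉C (Graph.sym Γ uv)))

  label-L21 : IsL21 Γ label
  label-L21 = (λ _ _ → label-apart) , (λ _ _ → label-injective ∘ proj₁)

  label-bounded : ∀ v → label v ≤ 2 * ∣ C ∣ ∸ 2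
  label-bounded v = m+n≤o⇒m≤o∸n (label v) (label+2 (toSum (v ∈? C)))
    where
    label+2 : v ∈ C ⊎ v ∉ C → label v + 2 ≤ 2 * ∣ C ∣
    label+2 (inj₁ vC)  rewrite label-∈ vC  = double-< {rank v} (<-≤-trans (rank-bounded vC) (below≤∣C∣ _))
    label+2 (inj₂ v∉C) rewrite label-∉ v∉C = double-suc-< {gap v} (<-≤-trans (gap-bounded v∉C) (below≤∣C∣ _))

proposition2p3 : (n : ℕ) → 1 ≤ n → (Γ : Graph n) → (C : Subset n) → IsMaximumClique Γ C
    → (s : ℕ) → (a : Fin n → Fin s) → (c : Fin n → Fin (suc s))
    → (∀ i → cardA C a i + 1 ≤ cardC C c (inject₁ i))
    → (∀ i u v → u ∉ C → a u ≡ i → v ∈ C → c v ≡ inject₁ i → ¬ Adj Γ u v)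
    → IsLambda Γ (2 * ∣ C ∣ ∸ 2)
proposition2p3 n _ Γ C (clique , _) s a c |Aᵢ|<|Cᵢ| Aᵢ≁Cᵢ =
  (label , label-L21 , ≤-antisym (span≤ label-bounded) (clique-span Γ clique label-L21)) ,
  (λ _ → clique-span Γ clique)
  where open Labelling Γ C a c |Aᵢ|<|Cᵢ| Aᵢ≁Cᵢ
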